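{- Let $c\in\mathbb N$ and let $\mathscr G^<$ be a class of ordered graphs $(V,E,<)$ whose underlying graphs $(V,E)$ all have star chromatic number at most $c$. Then there exist a copying transduction $\mathsf T_1$ with blowing factor $c+1$, a simple transduction $\mathsf T_2$, and a class $\mathscr P$ of permutations such that $(\mathsf T_1,\mathsf T_2)$ is a transduction pairing of $\mathscr G^<$ and $\mathscr P$.
   Context: An ordered graph is a structure $(V,E,<)$ with $E$ a symmetric irreflexive relation and $<$ a linear order. A permutation is a structure $(V,<_1,<_2)$ with two linear orders on a finite set $V$. A star coloring is a proper vertex coloring in which any two color classes induce a star forest; the star chromatic number is the least number of colors in one. Transductions: a simple interpretation $\mathsf I$ of $\Sigma'$-structures in $\Sigma$-structures is given by first-order formulas $\rho_0(x)$ and $\rho_{R'}(x_1,\dots,x_r)$ for each $r$-ary $R'\in\Sigma'$; $\mathsf I(\mathbf A)$ has domain $\{a:\mathbf A\models\rho_0(a)\}$ and $R'$ interpreted by tuples of the domain satisfying $\rho_{R'}$. A simple transduction $\mathsf T$ is given by a simple interpretation in $\Sigma^+$-structures, $\Sigma^+$ being $\Sigma$ plus finitely many unary symbols (marks), with $\mathsf T(\mathbf A)$ the set of outputs over all expansions of $\mathbf A$ by the marks. The $m$-blowing $\mathbf A\bullet m$ has domain $A\times[m]$, the relations of $\mathbf A$ pulled back along the projection $p$, and a new binary relation $\sim$ with $x\sim y$ iff $p(x)=p(y)$. A copying transduction is an $m$-blowing followed by a simple transduction; $m$ is its blowing factor. A transduction pairing of classes $\mathscr C,\mathscr D$ is a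 pair $(\mathsf D,\mathsf C)$ of transductions such that for every $\mathbf A\in\mathscr C$ there is $\mathbf B\in\mathsf D(\mathbf A)\cap\mathscr D$ with $\mathbf A\in\mathsf C(\mathbf B)$, and for every $\mathbf B\in\mathscr D$ there is $\mathbf A\in\mathsf C(\mathbf B)\cap\mathscr C$ with $\mathbf B\in\mathsf D(\mathbf A)$. -}

module Defs where

open import Data.Nat using (ℕ; zero; suc; _*_)
open import Data.Fin using (Fin; zero; suc; quotient)
open import Data.Fin.Properties using () renaming (_≟_ to _≟ᶠ_)
open import Data.Vec using (Vec; []; _∷_; lookup; map)
open import Data.Bool using (Bool; true; false; _∧_; _∨_; not)
open import Data.Unit using (⊤; tt)
open import Data.Sum using (_⊎_; inj₁; inj₂; [_,_])
open import Data.Product using (Σ; ∃; _×_; _,_)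
open import Relation.Nullary using (¬_; does)
open import Relation.Binary.PropositionalEquality using (_≡_; _≢_)
open import Function.Definitions using (Injective)

record Sig : Set₁ where
  field
    Sym : Set
    ar  : Sym → ℕ
open Sig public

record Str (σ : Sig) : Set where
  field
    size : ℕ
    rel  : (s : Sym σ) → Vec (Fin size) (ar σ s) → Bool
open Str public

data Formula (σ : Sig) : ℕ → Set where
  R    : ∀ {k} (s : Sym σ) → Vec (Fin k) (ar σ s) → Formula σ k
  _≐_  : ∀ {k} → Fin k → Fin k → Formula σ k
  ⊤'   : ∀ {k} → Formula σ k
  ¬'   : ∀ {k} → Formula σ k → Formula σ k
  _∧'_ : ∀ {k} → Formula σ k → Formula σ k → Formula σ k
  _∨'_ : ∀ {k} → Formula σ k → Formula σ k → Formula σ k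
  ∃'   : ∀ {k} → Formula σ (suc k) → Formula σ k
  ∀'   : ∀ {k} → Formula σ (suc k) → Formula σ k

anyFin : (n : ℕ) → (Fin n → Bool) → Bool
anyFin zero    f = false
anyFin (suc n) f = f zero ∨ anyFin n (λ i → f (suc i))

allFin : (n : ℕ) → (Fin n → Bool) → Bool
allFin zero    f = true
allFin (suc n) f = f zero ∧ allFin n (λ i → f (suc i))

extend : ∀ {A : Set} {k} → A → (Fin k → A) → Fin (suc k) → A
extend a ρ zero    = a
extend a ρ (suc i) = ρ i

⟦_⟧ : ∀ {σ k} → Formula σ k → (A : Str σ) → (Fin k → Fin (size A)) → Bool
⟦ R s xs  ⟧ A ρ = rel A s (map ρ xs)
⟦ x ≐ y   ⟧ A ρ = does (ρ x ≟ᶠ ρ y)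
⟦ ⊤'      ⟧ A ρ = true
⟦ ¬' φ    ⟧ A ρ = not (⟦ φ ⟧ A ρ)
⟦ φ ∧' ψ  ⟧ A ρ = ⟦ φ ⟧ A ρ ∧ ⟦ ψ ⟧ A ρ
⟦ φ ∨' ψ  ⟧ A ρ = ⟦ φ ⟧ A ρ ∨ ⟦ ψ ⟧ A ρ
⟦ ∃' φ    ⟧ A ρ = anyFin (size A) (λ a → ⟦ φ ⟧ A (extend a ρ))
⟦ ∀' φ    ⟧ A ρ = allFin (size A) (λ a → ⟦ φ ⟧ A (extend a ρ))

record Interp (σ τ : Sig) : Set where
  field
    ρ₀   : Formula σ 1
    ρRel : (s : Sym τ) → Formula σ (ar τ s)
open Interp public

-- IsInterpOf I A B : B is (isomorphic to) I(A).  The map f identifies the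
-- domain of B bijectively with {a ∈ A : A ⊨ ρ₀(a)} and transports relations.
IsInterpOf : ∀ {σ τ} → Interp σ τ → Str σ → Str τ → Set
IsInterpOf {σ} {τ} I A B =
  Σ (Fin (size B) → Fin (size A)) λ f →
    Injective _≡_ _≡_ f
  × (∀ b → ⟦ ρ₀ I ⟧ A (λ _ → f b) ≡ true)
  × (∀ a → ⟦ ρ₀ I ⟧ A (λ _ → a) ≡ true → ∃ λ b → f b ≡ a)
  × (∀ (s : Sym τ) (t : Vec (Fin (size B)) (ar τ s)) →
       rel B s t ≡ ⟦ ρRel I s ⟧ A (λ i → f (lookup t i)))

_⁺_ : Sig → ℕ → Sig
σ ⁺ m = record { Sym = Sym σ ⊎ Fin m ; ar = [ ar σ , (λ _ → 1) ] }

expand : ∀ {σ} (A : Str σ) (m : ℕ) → (Fin m → Fin (size A) → Bool) → Str (σ ⁺ m)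
expand {σ} A m M = record
  { size = size A
  ; rel  = λ { (inj₁ s) t → rel A s t ; (inj₂ j) (a ∷ []) → M j a } }

record SimpleTrans (σ τ : Sig) : Set₁ where
  field
    marks  : ℕ
    interp : Interp (σ ⁺ marks) τ
open SimpleTrans public

_∋ₛ_⟶_ : ∀ {σ τ} → SimpleTrans σ τ → Str σ → Str τ → Set
T ∋ₛ A ⟶ B = Σ (Fin (marks T) → Fin (size A) → Bool) λ M →
               IsInterpOf (interp T) (expand A (marks T) M) B

blowSig : Sig → Sig
blowSig σ = record { Sym = Sym σ ⊎ ⊤ ; ar = [ ar σ , (λ _ → 2) ] }

-- A • m : domain A × [m], encoded as Fin (size A * m) with projection `quotient m`
_•_ : ∀ {σ} → Str σ → ℕ → Str (blowSig σ)
_•_ {σ} A m = record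
  { size = size A * m
  ; rel  = λ { (inj₁ s) t → rel A s (map (quotient m) t)
             ; (inj₂ tt) (x ∷ y ∷ []) → does (quotient m x ≟ᶠ quotient {size A} m y) } }

record CopyingTrans (σ τ : Sig) : Set₁ where
  field
    blowing : ℕ
    simple  : SimpleTrans (blowSig σ) τ
open CopyingTrans public

_∋꜀_⟶_ : ∀ {σ τ} → CopyingTrans σ τ → Str σ → Str τ → Set
T ∋꜀ A ⟶ B = simple T ∋ₛ (A • blowing T) ⟶ B

-- Transduction pairings (transductions given by their input/output relation)

TransductionPairing : ∀ {σ τ} → (Str σ → Set) → (Str τ → Set)
  → (Str σ → Str τ → Set) → (Str τ → Str σ → Set) → Set
TransductionPairing 𝒞 𝒟 D C =
    (∀ A → 𝒞 A → Σ _ λ B → D A B × 𝒟 B × C B A)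
  × (∀ B → 𝒟 B → Σ _ λ A → C B A × 𝒞 A × D A B)

data GSym : Set where
  edge less : GSym

GSig : Sig
GSig = record { Sym = GSym ; ar = λ _ → 2 }

data PSym : Set where
  less₁ less₂ : PSym

PSig : Sig
PSig = record { Sym = PSym ; ar = λ _ → 2 }

IsLinearOrder : (n : ℕ) → (Fin n → Fin n → Bool) → Set
IsLinearOrder n r =
    (∀ x → r x x ≡ false)
  × (∀ x y z → r x y ≡ true → r y z ≡ true → r x z ≡ true)
  × (∀ x y → x ≢ y → r x y ≡ true ⊎ r y x ≡ true)

Edge : (G : Str GSig) → Fin (size G) → Fin (size G) → Bool
Edge G x y = rel G edge (x ∷ y ∷ [])

IsOrderedGraph : Str GSig → Set
IsOrderedGraph G =
    (∀ x y → Edge G x y ≡ Edge G y x)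
  × (∀ x → Edge G x x ≡ false)
  × IsLinearOrder (size G) (λ x y → rel G less (x ∷ y ∷ []))

IsPermutation : Str PSig → Set
IsPermutation P =
    IsLinearOrder (size P) (λ x y → rel P less₁ (x ∷ y ∷ []))
  × IsLinearOrder (size P) (λ x y → rel P less₂ (x ∷ y ∷ []))

-- The subgraph of (Fin n, E) induced on S is a star forest, i.e. a
-- vertex-disjoint union of stars K_{1,t} (t ≥ 0): each vertex v of S is
-- assigned the centre ctr v of its star; the stars are the fibres of ctr,
-- and the edges inside S are exactly the centre–leaf pairs of each star.
IsStarForestOn : (n : ℕ) → (Fin n → Fin n → Bool) → (Fin n → Set) → Set
IsStarForestOn n E S =
  Σ (Fin n → Fin n) λ ctr →
      (∀ v → S v → S (ctr v) × ctr (ctr v) ≡ ctr v)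
    × (∀ u w → S u → S w →
         (E u w ≡ true → ctr u ≡ ctr w × u ≢ w × (u ≡ ctr u ⊎ w ≡ ctr w))
       × (ctr u ≡ ctr w → u ≢ w → (u ≡ ctr u ⊎ w ≡ ctr w) → E u w ≡ true))

IsStarColoring : (G : Str GSig) (c : ℕ) → (Fin (size G) → Fin c) → Set
IsStarColoring G c col =
    (∀ x y → Edge G x y ≡ true → col x ≢ col y)
  × (∀ i j → i ≢ j →
       IsStarForestOn (size G) (Edge G) (λ v → col v ≡ i ⊎ col v ≡ j))

StarChromatic≤ : Str GSig → ℕ → Set
StarChromatic≤ G c = Σ (Fin (size G) → Fin c) (IsStarColoring G c)

module Submission where

-- Blow every vertex v up into copies (v,0),…,(v,c). A star colouring orients each edge uv towards the centre of
-- the star containing it in the forest of the colours of u and v; then every vertex points to at most one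
-- neighbour of each colour j, and the copy (u, j+1) can serve as a pointer to it (marks make pointers definable).
-- The first order lists the copies vertex by vertex in the order of G; the second lists, after all copies that
-- point nowhere, each vertex copy (v,0) immediately followed by the copies pointing to v. Marking the vertex
-- copies, u points to v exactly when some pointer copy lies in the block of (u,0) in the first order and in the
-- block of (v,0) in the second, so the ordered graph is recovered from the permutation by a simple transduction.

open import Defs
open import Data.Bool using (Bool; true; false; _∧_; _∨_; not; if_then_else_)
import Data.Bool.Properties as Bool
open import Data.Bool.Properties using (⇔→≡; ¬-not; ∨-zeroʳ; ∨-identityʳ; ∧-zeroʳ)
open import Data.Empty using (⊥; ⊥-elim)
open import Data.Fin using (Fin; zero; suc; _<_; quotient; remainder; combine)
import Data.Fin.Properties as Fin
open import Data.Fin.Properties using (+↔⊎; *↔×; remQuot-combine; combine-remQuot; combine-injectiveˡ)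
open import Data.Nat using (ℕ; zero; suc; _+_; _*_; z<s)
open import Data.Product using (Σ; ∃; _×_; _,_; proj₁; proj₂; uncurry)
open import Data.Product.Properties using (≡-dec; ,-injective; ,-injectiveʳ)
open import Data.Sum using (_⊎_; inj₁; inj₂) renaming (map to map-⊎)
open import Data.Sum.Function.Propositional using (_⊎-↔_)
open import Data.Unit using (tt)
open import Data.Vec using (Vec; []; _∷_; lookup)
open import Function.Base using (_∘_; id)
open import Function.Bundles using (mk⇔; _↔_; Inverse)
open import Function.Definitions using (Injective)
open import Function.Properties.Inverse using (↔-refl; ↔-trans)
open import Relation.Binary using (DecidableEquality; IsStrictTotalOrder; Tri; tri<; tri≈; tri>)
open import Relation.Binary.PropositionalEquality using (_≡_; _≢_; refl; sym; trans; cong; cong₂; subst; subst₂)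
open import Relation.Nullary using (Dec; yes; no; does)
open import Relation.Nullary.Decidable using (dec-true; dec-false; does-⇔; _×-dec_)

∧-≡true⁻ : ∀ {a b} → a ∧ b ≡ true → a ≡ true × b ≡ true
∧-≡true⁻ {true} {true} _ = refl , refl

∨-≡true⁻ : ∀ {a b} → a ∨ b ≡ true → a ≡ true ⊎ b ≡ true
∨-≡true⁻ {true}  _ = inj₁ refl
∨-≡true⁻ {false} e = inj₂ e

∧-≡true : ∀ {a b} → a ≡ true → b ≡ true → a ∧ b ≡ true
∧-≡true refl refl = refl

∨-≡trueˡ : ∀ {a b} → a ≡ true → a ∨ b ≡ true
∨-≡trueˡ refl = refl

∨-≡trueʳ : ∀ a {b} → b ≡ true → a ∨ b ≡ true
∨-≡trueʳ a refl = ∨-zeroʳ a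

does-true⇒ : ∀ {P : Set} (d : Dec P) → does d ≡ true → P
does-true⇒ (yes p) _ = p

true≢false : ∀ {a} → a ≡ true → a ≡ false → ⊥
true≢false refl ()

anyFin⇒∃ : ∀ n {f : Fin n → Bool} → anyFin n f ≡ true → ∃ λ i → f i ≡ true
anyFin⇒∃ (suc n) {f} e with ∨-≡true⁻ {f zero} e
... | inj₁ e₀ = zero , e₀
... | inj₂ e₁ with anyFin⇒∃ n e₁
...   | i , eᵢ = suc i , eᵢ

∃⇒anyFin : ∀ n {f : Fin n → Bool} i → f i ≡ true → anyFin n f ≡ true
∃⇒anyFin (suc n) zero    e rewrite e = refl
∃⇒anyFin (suc n) {f} (suc i) e with f zero
... | true  = refl
... | false = ∃⇒anyFin n i e

allFin⇒∀ : ∀ n {f : Fin n → Bool} → allFin n f ≡ true → ∀ i → f i ≡ true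
allFin⇒∀ (suc n)     e zero    = proj₁ (∧-≡true⁻ e)
allFin⇒∀ (suc n) {f} e (suc i) = allFin⇒∀ n (proj₂ (∧-≡true⁻ {f zero} e)) i

∀⇒allFin : ∀ n {f : Fin n → Bool} → (∀ i → f i ≡ true) → allFin n f ≡ true
∀⇒allFin zero    h = refl
∀⇒allFin (suc n) h rewrite h zero = ∀⇒allFin n (λ i → h (suc i))

anyFin-false : ∀ n {f : Fin n → Bool} → (∀ i → f i ≡ false) → anyFin n f ≡ false
anyFin-false zero    h = refl
anyFin-false (suc n) h rewrite h zero = anyFin-false n (λ i → h (suc i))

anyFin-cong : ∀ n {f g : Fin n → Bool} → (∀ i → f i ≡ g i) → anyFin n f ≡ anyFin n g
anyFin-cong zero    h = refl
anyFin-cong (suc n) h = cong₂ _∨_ (h zero) (anyFin-cong n (λ i → h (suc i)))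

allFin-cong : ∀ n {f g : Fin n → Bool} → (∀ i → f i ≡ g i) → allFin n f ≡ allFin n g
allFin-cong zero    h = refl
allFin-cong (suc n) h = cong₂ _∧_ (h zero) (allFin-cong n (λ i → h (suc i)))

anyFin-∧ˡ : ∀ n b {f : Fin n → Bool} → anyFin n (λ i → b ∧ f i) ≡ b ∧ anyFin n f
anyFin-∧ˡ n true  = refl
anyFin-∧ˡ n false = anyFin-false n (λ _ → refl)

anyFin-≟ : ∀ {A : Set} (_≟_ : DecidableEquality A) n (k : Fin n → A) a (g : A → Bool) →
  (∃ λ i → k i ≡ a) → anyFin n (λ i → does (a ≟ k i) ∧ g (k i)) ≡ g a
anyFin-≟ _≟_ n k a g (i₀ , kᵢ₀≡a) = ⇔→≡ (mk⇔ selected (∃⇒anyFin n i₀ ∘ chosen))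
  where
  selected : anyFin n (λ i → does (a ≟ k i) ∧ g (k i)) ≡ true → g a ≡ true
  selected e with anyFin⇒∃ n e
  ... | i , eᵢ with ∧-≡true⁻ {does (a ≟ k i)} eᵢ
  ...   | a≟kᵢ , gkᵢ = subst (λ b → g b ≡ true) (sym (does-true⇒ (a ≟ k i) a≟kᵢ)) gkᵢ
  chosen : g a ≡ true → does (a ≟ k i₀) ∧ g (k i₀) ≡ true
  chosen e rewrite kᵢ₀≡a | dec-true (a ≟ a) refl = e

anyFin-surjective : ∀ {n N} (k : Fin N → Fin n) → (∀ v → ∃ λ a → k a ≡ v) → (g : Fin n → Bool) →
  anyFin N (λ a → g (k a)) ≡ anyFin n g
anyFin-surjective {n} {N} k k-onto g = ⇔→≡ (mk⇔ forth back)
  where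
  forth : anyFin N (λ a → g (k a)) ≡ true → anyFin n g ≡ true
  forth e = let a , gka = anyFin⇒∃ N e in ∃⇒anyFin n (k a) gka
  back : anyFin n g ≡ true → anyFin N (λ a → g (k a)) ≡ true
  back e with anyFin⇒∃ n e
  ... | v , gv with k-onto v
  ...   | a , refl = ∃⇒anyFin N a gv

does-≡-dec : ∀ {A B : Set} (_≟ᴬ_ : DecidableEquality A) (_≟ᴮ_ : DecidableEquality B) (a a′ : A) (b b′ : B) →
  does (≡-dec _≟ᴬ_ _≟ᴮ_ (a , b) (a′ , b′)) ≡ does (a ≟ᴬ a′) ∧ does (b ≟ᴮ b′)
does-≡-dec _≟ᴬ_ _≟ᴮ_ a a′ b b′ =
  does-⇔ (mk⇔ ,-injective (λ { (refl , refl) → refl }))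
         (≡-dec _≟ᴬ_ _≟ᴮ_ (a , b) (a′ , b′)) ((a ≟ᴬ a′) ×-dec (b ≟ᴮ b′))

IsStrictLinear : (A : Set) → (A → A → Bool) → Set
IsStrictLinear A r =
    (∀ x → r x x ≡ false)
  × (∀ x y z → r x y ≡ true → r y z ≡ true → r x z ≡ true)
  × (∀ x y → x ≢ y → r x y ≡ true ⊎ r y x ≡ true)

linear-asym : ∀ {A r} → IsStrictLinear A r → ∀ {x y} → r x y ≡ true → r y x ≡ true → ⊥
linear-asym (irrefl , transitive , _) {x} xy yx = true≢false (transitive x _ x xy yx) (irrefl x)

linear-pullback : ∀ {A B r} → IsStrictLinear A r → (k : B → A) → Injective _≡_ _≡_ k →
  IsStrictLinear B (λ x y → r (k x) (k y))
linear-pullback (irrefl , transitive , total) k k-injective =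
    (λ x → irrefl (k x))
  , (λ x y z → transitive (k x) (k y) (k z))
  , λ x y x≢y → total (k x) (k y) (x≢y ∘ k-injective)

strictTotalOrder⇒linear : ∀ {A : Set} {_<_ : A → A → Set} → IsStrictTotalOrder _≡_ _<_ →
  (_<?_ : ∀ x y → Dec (x < y)) → IsStrictLinear A (λ x y → does (x <? y))
strictTotalOrder⇒linear {_<_ = _<_} sto _<?_ =
    (λ x → dec-false (x <? x) (irrefl refl))
  , (λ x y z xy yz → dec-true (x <? z) (<-trans (does-true⇒ (x <? y) xy) (does-true⇒ (y <? z) yz)))
  , total
  where
  open IsStrictTotalOrder sto using (irrefl; compare) renaming (trans to <-trans)
  total : ∀ x y → x ≢ y → does (x <? y) ≡ true ⊎ does (y <? x) ≡ true
  total x y x≢y with compare x y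
  ... | tri< x<y _ _ = inj₁ (dec-true (x <? y) x<y)
  ... | tri≈ _ x≡y _ = ⊥-elim (x≢y x≡y)
  ... | tri> _ _ y<x = inj₂ (dec-true (y <? x) y<x)

-- Opaque, so that r and s can be inferred from a goal about lex; lex-≡ is its defining equation.
opaque
  lex : ∀ {A B : Set} → DecidableEquality A → (A → A → Bool) → (B → B → Bool) → A × B → A × B → Bool
  lex _≟_ r s (a , b) (a′ , b′) = r a a′ ∨ (does (a ≟ a′) ∧ s b b′)

  lex-≡ : ∀ {A B : Set} (_≟_ : DecidableEquality A) (r : A → A → Bool) (s : B → B → Bool) a a′ b b′ →
    lex _≟_ r s (a , b) (a′ , b′) ≡ r a a′ ∨ (does (a ≟ a′) ∧ s b b′)
  lex-≡ _ _ _ _ _ _ _ = refl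

module _ {A B : Set} (_≟_ : DecidableEquality A) {r : A → A → Bool} {s : B → B → Bool} where

  lex⁻ : ∀ {a a′ b b′} → lex _≟_ r s (a , b) (a′ , b′) ≡ true →
    r a a′ ≡ true ⊎ (a ≡ a′ × s b b′ ≡ true)
  lex⁻ {a} {a′} {b} {b′} e with ∨-≡true⁻ {r a a′} (trans (sym (lex-≡ _≟_ r s a a′ b b′)) e)
  ... | inj₁ ra = inj₁ ra
  ... | inj₂ eqs with ∧-≡true⁻ {does (a ≟ a′)} eqs
  ...   | a≟a′ , sb = inj₂ (does-true⇒ (a ≟ a′) a≟a′ , sb)

  lex-head : ∀ {a a′ b b′} → r a a′ ≡ true → lex _≟_ r s (a , b) (a′ , b′) ≡ true
  lex-head {a} {a′} {b} {b′} ra = trans (lex-≡ _≟_ r s a a′ b b′) (∨-≡trueˡ ra)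

  lex-tail : ∀ {a b b′} → s b b′ ≡ true → lex _≟_ r s (a , b) (a , b′) ≡ true
  lex-tail {a} {b} {b′} sb =
    trans (lex-≡ _≟_ r s a a b b′) (∨-≡trueʳ (r a a) (∧-≡true (dec-true (a ≟ a) refl) sb))

  lex-same-tail : ∀ {a a′ b} → s b b ≡ false → lex _≟_ r s (a , b) (a′ , b) ≡ r a a′
  lex-same-tail {a} {a′} {b} sbb =
    trans (lex-≡ _≟_ r s a a′ b b)
          (trans (cong (λ t → r a a′ ∨ (does (a ≟ a′) ∧ t)) sbb)
                 (trans (cong (r a a′ ∨_) (∧-zeroʳ (does (a ≟ a′)))) (∨-identityʳ (r a a′))))

  lex-linear : IsStrictLinear A r → IsStrictLinear B s → IsStrictLinear (A × B) (lex _≟_ r s)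
  lex-linear (irrᴬ , transᴬ , totalᴬ) (irrᴮ , transᴮ , totalᴮ) = irr , transitive , total
    where
    irr : ∀ x → lex _≟_ r s x x ≡ false
    irr (a , b) = trans (lex-≡ _≟_ r s a a b b)
                        (cong₂ _∨_ (irrᴬ a) (trans (cong (_∧ s b b) (dec-true (a ≟ a) refl)) (irrᴮ b)))
    transitive : ∀ x y z → lex _≟_ r s x y ≡ true → lex _≟_ r s y z ≡ true → lex _≟_ r s x z ≡ true
    transitive (a , b) (a′ , b′) (a″ , b″) xy yz with lex⁻ xy | lex⁻ yz
    ... | inj₁ ra          | inj₁ ra′          = lex-head (transᴬ a a′ a″ ra ra′)
    ... | inj₁ ra          | inj₂ (refl , _)   = lex-head ra
    ... | inj₂ (refl , _)  | inj₁ ra′          = lex-head ra′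
    ... | inj₂ (refl , sb) | inj₂ (refl , sb′) = lex-tail (transᴮ b b′ b″ sb sb′)
    total : ∀ x y → x ≢ y → lex _≟_ r s x y ≡ true ⊎ lex _≟_ r s y x ≡ true
    total (a , b) (a′ , b′) x≢y = by-cases (a ≟ a′)
      where
      by-cases : Dec (a ≡ a′) → lex _≟_ r s (a , b) (a′ , b′) ≡ true ⊎ lex _≟_ r s (a′ , b′) (a , b) ≡ true
      by-cases (no a≢a′)  = map-⊎ lex-head lex-head (totalᴬ a a′ a≢a′)
      by-cases (yes refl) = map-⊎ lex-tail lex-tail (totalᴮ b b′ (x≢y ∘ cong (a ,_)))

module Blocks {N : ℕ} (_<_ : Fin N → Fin N → Bool) (Z : Fin N → Bool) where

  _◁_ : Fin N → Fin N → Bool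
  a ◁ z = (a < z) ∧ allFin N (λ w → not (Z w ∧ ((a < w) ∧ (w < z))))

  ◁-intro : ∀ {a z} → a < z ≡ true → (∀ w → Z w ≡ true → a < w ≡ true → w < z ≡ true → ⊥) → a ◁ z ≡ true
  ◁-intro a<z no-Z-between rewrite a<z =
    ∀⇒allFin N λ w → cong not (¬-not λ e →
      let Zw , between = ∧-≡true⁻ e ; a<w , w<z = ∧-≡true⁻ between in no-Z-between w Zw a<w w<z)

  ◁-elim : ∀ {a z} → a ◁ z ≡ true → a < z ≡ true × (∀ w → Z w ≡ true → a < w ≡ true → w < z ≡ true → ⊥)
  ◁-elim {a} {z} e =
    let a<z , none = ∧-≡true⁻ e in
    a<z , λ w Zw a<w w<z → true≢false (allFin⇒∀ N none w) (cong not (∧-≡true Zw (∧-≡true a<w w<z)))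

  module Characterisation (lin : IsStrictLinear (Fin N) _<_)
           {Y : Set} (_≟_ : DecidableEquality Y) {_≺_ : Y → Y → Bool} (linY : IsStrictLinear Y _≺_)
           (φ : Fin N → Y)
           (≺⇒< : ∀ x y → φ x ≺ φ y ≡ true → x < y ≡ true)
           (Z-first : ∀ a z → Z a ≡ true → Z z ≡ false → φ a ≡ φ z → a < z ≡ true)
           (φ-injective-on-Z : ∀ a w → Z a ≡ true → Z w ≡ true → φ a ≡ φ w → a ≡ w)
           where

    <⇒≼ : ∀ {x y} → x < y ≡ true → φ x ≡ φ y ⊎ φ x ≺ φ y ≡ true
    <⇒≼ {x} {y} x<y with φ x ≟ φ y
    ... | yes φx≡φy = inj₁ φx≡φy
    ... | no φx≢φy = inj₂ (reduce (proj₂ (proj₂ linY) (φ x) (φ y) φx≢φy))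
      where
      reduce : φ x ≺ φ y ≡ true ⊎ φ y ≺ φ x ≡ true → φ x ≺ φ y ≡ true
      reduce (inj₁ φx≺φy) = φx≺φy
      reduce (inj₂ φy≺φx) = ⊥-elim (linear-asym lin x<y (≺⇒< y x φy≺φx))

    ◁-of-same-image : ∀ {a z} → Z a ≡ true → Z z ≡ false → φ a ≡ φ z → a ◁ z ≡ true
    ◁-of-same-image {a} {z} Za Zz φa≡φz = ◁-intro (Z-first a z Za Zz φa≡φz) Z-between
      where
      Z-between : ∀ w → Z w ≡ true → a < w ≡ true → w < z ≡ true → ⊥
      Z-between w Zw a<w w<z with <⇒≼ a<w
      ... | inj₁ φa≡φw = true≢false a<w (subst (λ b → a < b ≡ false) (φ-injective-on-Z a w Za Zw φa≡φw) (proj₁ lin a))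
      ... | inj₂ φa≺φw = linear-asym lin w<z (≺⇒< z w (subst (λ y → y ≺ φ w ≡ true) φa≡φz φa≺φw))

    ◁-same-image : ∀ {a z w} → Z z ≡ false → Z w ≡ true → φ w ≡ φ z → a ◁ z ≡ true → φ a ≡ φ z
    ◁-same-image {a} {z} {w} Zz Zw φw≡φz a◁z with ◁-elim a◁z
    ... | a<z , no-Z-between with <⇒≼ a<z
    ...   | inj₁ φa≡φz = φa≡φz
    ...   | inj₂ φa≺φz = ⊥-elim (no-Z-between w Zw (≺⇒< a w (subst (λ y → φ a ≺ y ≡ true) (sym φw≡φz) φa≺φz))
                                                    (Z-first w z Zw Zz φw≡φz))

⋁ : ∀ {σ k} n → (Fin n → Formula σ k) → Formula σ k
⋁ zero    φ = ¬' ⊤'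
⋁ (suc n) φ = φ zero ∨' ⋁ n (λ i → φ (suc i))

ifF : ∀ {σ k} → Formula σ k → Formula σ k → Formula σ k → Formula σ k
ifF φ ψ χ = (φ ∧' ψ) ∨' (¬' φ ∧' χ)

lexF : ∀ {σ k} → Formula σ k → Formula σ k → Formula σ k → Formula σ k
lexF φ< φ≡ ψ = φ< ∨' (φ≡ ∧' ψ)

boolLtF boolEqF : ∀ {σ k} → Formula σ k → Formula σ k → Formula σ k
boolLtF φ ψ = ¬' φ ∧' ψ
boolEqF φ ψ = (φ ∧' ψ) ∨' (¬' φ ∧' ¬' ψ)

boolLt : Bool → Bool → Bool
boolLt a b = does (a Bool.<? b)

boolLt-linear : IsStrictLinear Bool boolLt
boolLt-linear = strictTotalOrder⇒linear Bool.<-isStrictTotalOrder Bool._<?_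

module _ {σ : Sig} (A : Str σ) {k : ℕ} (ρ : Fin k → Fin (size A)) where

  ⟦⋁⟧ : ∀ n (φ : Fin n → Formula σ k) → ⟦ ⋁ n φ ⟧ A ρ ≡ anyFin n (λ i → ⟦ φ i ⟧ A ρ)
  ⟦⋁⟧ zero    φ = refl
  ⟦⋁⟧ (suc n) φ = cong (⟦ φ zero ⟧ A ρ ∨_) (⟦⋁⟧ n (λ i → φ (suc i)))

  ⟦ifF⟧ : ∀ φ ψ χ → ⟦ ifF φ ψ χ ⟧ A ρ ≡ (if ⟦ φ ⟧ A ρ then ⟦ ψ ⟧ A ρ else ⟦ χ ⟧ A ρ)
  ⟦ifF⟧ φ ψ χ with ⟦ φ ⟧ A ρ
  ... | true  = ∨-identityʳ (⟦ ψ ⟧ A ρ)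
  ... | false = refl

  ⟦boolLtF⟧ : ∀ φ ψ {a b} → ⟦ φ ⟧ A ρ ≡ a → ⟦ ψ ⟧ A ρ ≡ b → ⟦ boolLtF φ ψ ⟧ A ρ ≡ boolLt a b
  ⟦boolLtF⟧ _ _ {a} {b} eφ eψ = trans (cong₂ (λ x y → not x ∧ y) eφ eψ) (boolLt-spec a b)
    where
    boolLt-spec : ∀ a b → not a ∧ b ≡ boolLt a b
    boolLt-spec false false = refl
    boolLt-spec false true  = refl
    boolLt-spec true  _     = refl

  ⟦boolEqF⟧ : ∀ φ ψ {a b} → ⟦ φ ⟧ A ρ ≡ a → ⟦ ψ ⟧ A ρ ≡ b →
    ⟦ boolEqF φ ψ ⟧ A ρ ≡ does (a Bool.≟ b)
  ⟦boolEqF⟧ _ _ {a} {b} eφ eψ = trans (cong₂ (λ x y → (x ∧ y) ∨ (not x ∧ not y)) eφ eψ) (boolEq-spec a b)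
    where
    boolEq-spec : ∀ a b → (a ∧ b) ∨ (not a ∧ not b) ≡ does (a Bool.≟ b)
    boolEq-spec false false = refl
    boolEq-spec false true  = refl
    boolEq-spec true  false = refl
    boolEq-spec true  true  = refl

  ⟦lexF⟧ : ∀ {X Y : Set} {_≟_ : DecidableEquality X} {r : X → X → Bool} {s : Y → Y → Bool} {x x′ y y′}
    φ< φ≡ ψ →
    ⟦ φ< ⟧ A ρ ≡ r x x′ → ⟦ φ≡ ⟧ A ρ ≡ does (x ≟ x′) → ⟦ ψ ⟧ A ρ ≡ s y y′ →
    ⟦ lexF φ< φ≡ ψ ⟧ A ρ ≡ lex _≟_ r s (x , y) (x′ , y′)
  ⟦lexF⟧ {_≟_ = _≟_} {r} {s} {x} {x′} {y} {y′} _ _ _ e< e≡ e =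
    trans (cong₂ _∨_ e< (cong₂ _∧_ e≡ e)) (sym (lex-≡ _≟_ r s x x′ y y′))

module StarColouring {G : Str GSig} {c : ℕ} {col : Fin (size G) → Fin c}
                     (star : IsStarColoring G c col) (E-sym : ∀ u v → Edge G u v ≡ Edge G v u) where

  private
    n : ℕ
    n = size G
    E : Fin n → Fin n → Bool
    E = Edge G

  centreBy : ∀ {i j} → Tri (i < j) (i ≡ j) (j < i) → Fin n → Fin n
  centreBy {i} {j} (tri< i<j _ _) = proj₁ (proj₂ star i j (Fin.<⇒≢ i<j))
  centreBy         (tri≈ _ _ _)   = id   -- junk: the two colours of an edge differ
  centreBy {i} {j} (tri> _ _ j<i) = proj₁ (proj₂ star j i (Fin.<⇒≢ j<i))

  centre : Fin c → Fin c → Fin n → Fin n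
  centre i j = centreBy (Fin.<-cmp i j)

  centre-sym : ∀ i j → centre i j ≡ centre j i
  centre-sym i j = centreBy-sym (Fin.<-cmp i j) (Fin.<-cmp j i)
    where
    centreBy-sym : (t : Tri (i < j) (i ≡ j) (j < i)) (t′ : Tri (j < i) (j ≡ i) (i < j)) →
      centreBy t ≡ centreBy t′
    centreBy-sym (tri< i<j _ _) (tri> _ _ i<j′) rewrite Fin.<-irrelevant i<j i<j′ = refl
    centreBy-sym (tri> _ _ j<i) (tri< j<i′ _ _) rewrite Fin.<-irrelevant j<i j<i′ = refl
    centreBy-sym (tri≈ _ _ _)   (tri≈ _ _ _)    = refl
    centreBy-sym (tri< _ _ j≮i) (tri< j<i _ _)  = ⊥-elim (j≮i j<i)
    centreBy-sym (tri< _ i≢j _) (tri≈ _ j≡i _)  = ⊥-elim (i≢j (sym j≡i))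
    centreBy-sym (tri≈ i≮j _ _) (tri> _ _ i<j)  = ⊥-elim (i≮j i<j)
    centreBy-sym (tri≈ _ _ j≮i) (tri< j<i _ _)  = ⊥-elim (j≮i j<i)
    centreBy-sym (tri> _ i≢j _) (tri≈ _ j≡i _)  = ⊥-elim (i≢j (sym j≡i))
    centreBy-sym (tri> i≮j _ _) (tri> _ _ i<j)  = ⊥-elim (i≮j i<j)

  centre-edge : ∀ {u v} → E u v ≡ true →
    centre (col u) (col v) u ≡ centre (col u) (col v) v × (u ≡ centre (col u) (col v) u ⊎ v ≡ centre (col u) (col v) v)
  centre-edge {u} {v} e = centreBy-edge (Fin.<-cmp (col u) (col v))
    where
    centreBy-edge : (t : Tri (col u < col v) (col u ≡ col v) (col v < col u)) →
      centreBy t u ≡ centreBy t v × (u ≡ centreBy t u ⊎ v ≡ centreBy t v)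
    centreBy-edge (tri< cu<cv _ _) =
      let forest = proj₂ star (col u) (col v) (Fin.<⇒≢ cu<cv)
          same , _ , one-is-centre = proj₁ (proj₂ (proj₂ forest) u v (inj₁ refl) (inj₂ refl)) e
      in same , one-is-centre
    centreBy-edge (tri≈ _ cu≡cv _) = ⊥-elim (proj₁ star u v e cu≡cv)
    centreBy-edge (tri> _ _ cv<cu) =
      let forest = proj₂ star (col v) (col u) (Fin.<⇒≢ cv<cu)
          same , _ , one-is-centre = proj₁ (proj₂ (proj₂ forest) u v (inj₂ refl) (inj₁ refl)) e
      in same , one-is-centre

  PointsTo : Fin n → Fin n → Bool
  PointsTo u v = E u v ∧ does (centre (col u) (col v) v Fin.≟ v)

  pointsTo⇒centre : ∀ {u v} → PointsTo u v ≡ true → centre (col u) (col v) u ≡ v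
  pointsTo⇒centre {u} {v} uv =
    let e , v-centre = ∧-≡true⁻ uv in
    trans (proj₁ (centre-edge e)) (does-true⇒ (centre (col u) (col v) v Fin.≟ v) v-centre)

  pointsTo-functional : ∀ {u v w} → PointsTo u v ≡ true → PointsTo u w ≡ true → col v ≡ col w → v ≡ w
  pointsTo-functional {u} uv uw cv≡cw =
    trans (sym (pointsTo⇒centre uv)) (trans (cong (λ j → centre (col u) j u) cv≡cw) (pointsTo⇒centre uw))

  edge-orientation : ∀ u v → E u v ≡ PointsTo u v ∨ PointsTo v u
  edge-orientation u v = ⇔→≡ (mk⇔ oriented unoriented)
    where
    oriented : E u v ≡ true → PointsTo u v ∨ PointsTo v u ≡ true
    oriented e with proj₂ (centre-edge e)
    ... | inj₂ v-centre = ∨-≡trueˡ (∧-≡true e (dec-true (_ Fin.≟ v) (sym v-centre)))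
    ... | inj₁ u-centre = ∨-≡trueʳ (PointsTo u v) (∧-≡true (trans (E-sym v u) e)
                            (dec-true (_ Fin.≟ u) (trans (cong (λ f → f u) (centre-sym (col v) (col u))) (sym u-centre))))
    unoriented : PointsTo u v ∨ PointsTo v u ≡ true → E u v ≡ true
    unoriented p with ∨-≡true⁻ {PointsTo u v} p
    ... | inj₁ uv = proj₁ (∧-≡true⁻ uv)
    ... | inj₂ vu = trans (E-sym u v) (proj₁ (∧-≡true⁻ vu))

Mark : ℕ → Set
Mark c = Fin (suc c) ⊎ Fin (suc c) ⊎ Fin c ⊎ (Fin c × Fin c)

pattern index-is l       = inj₁ l
pattern index-below l    = inj₂ (inj₁ l)
pattern colour-is i      = inj₂ (inj₂ (inj₁ i))
pattern is-centre-of i j = inj₂ (inj₂ (inj₂ (i , j)))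

#marks : ℕ → ℕ
#marks c = suc c + (suc c + (c + c * c))

mark-enumeration : ∀ c → Fin (#marks c) ↔ Mark c
mark-enumeration c = ↔-trans +↔⊎ (↔-refl ⊎-↔ ↔-trans +↔⊎ (↔-refl ⊎-↔ ↔-trans +↔⊎ (↔-refl ⊎-↔ *↔×)))

module OrderFormulas (c : ℕ) where

  Fm : ℕ → Set
  Fm = Formula (blowSig GSig ⁺ #marks c)

  markF : ∀ {k} → Mark c → Fin k → Fm k
  markF μ x = R (inj₂ (Inverse.from (mark-enumeration c) μ)) (x ∷ [])

  lessF edgeF sameVertexF : ∀ {k} → Fin k → Fin k → Fm k
  lessF x y       = R (inj₁ (inj₁ less)) (x ∷ y ∷ [])
  edgeF x y       = R (inj₁ (inj₁ edge)) (x ∷ y ∷ [])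
  sameVertexF x y = R (inj₁ (inj₂ tt)) (x ∷ y ∷ [])

  vertexCopyF : ∀ {k} → Fin k → Fm k
  vertexCopyF = markF (index-is zero)

  indexLtF : ∀ {k} → Fin k → Fin k → Fm k
  indexLtF x y = ⋁ (suc c) λ l → markF (index-is l) y ∧' markF (index-below l) x

  order₁F : ∀ {k} → Fin k → Fin k → Fm k
  order₁F x y = lexF (lessF x y) (sameVertexF x y) (indexLtF x y)

  pointerF : ∀ {k} → Fin k → Fin k → Fm k
  pointerF x a =
    ⋁ c λ i → markF (colour-is i) x ∧' ⋁ c λ j → markF (colour-is j) a ∧'
      (markF (index-is (suc j)) x ∧' (edgeF x a ∧' markF (is-centre-of i j) a))

  targetsF : ∀ {k} → Fin k → Fin k → Fm k
  targetsF x a = ifF (vertexCopyF x) (sameVertexF x a) (pointerF x a)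

  hasTargetF : ∀ {k} → Fin k → Fm k
  hasTargetF x = ∃' (targetsF (suc x) zero)

  targetIsF : ∀ {k} → Fin k → Fin k → Fm k
  targetIsF x a = ifF (hasTargetF x) (targetsF x a) (sameVertexF x a)

  onTargetsF : (∀ {k} → Fin k → Fin k → Fm k) → ∀ {k} → Fin k → Fin k → Fm k
  onTargetsF ψ x y = ∃' (∃' (targetIsF (suc (suc x)) (suc zero) ∧' (targetIsF (suc (suc y)) zero ∧' ψ (suc zero) zero)))

  order₂F : ∀ {k} → Fin k → Fin k → Fm k
  order₂F x y =
    lexF (lexF (boolLtF (hasTargetF x) (hasTargetF y)) (boolEqF (hasTargetF x) (hasTargetF y)) (onTargetsF lessF x y))
         (boolEqF (hasTargetF x) (hasTargetF y) ∧' onTargetsF sameVertexF x y)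
         (lexF (boolLtF (¬' (vertexCopyF x)) (¬' (vertexCopyF y)))
               (boolEqF (¬' (vertexCopyF x)) (¬' (vertexCopyF y)))
               (order₁F x y))

module EdgeFormulas where

  Fm : ℕ → Set
  Fm = Formula (PSig ⁺ 1)

  less₁F less₂F : ∀ {k} → Fin k → Fin k → Fm k
  less₁F x y = R (inj₁ less₁) (x ∷ y ∷ [])
  less₂F x y = R (inj₁ less₂) (x ∷ y ∷ [])

  markedF : ∀ {k} → Fin k → Fm k
  markedF x = R (inj₂ zero) (x ∷ [])

  blockF : (∀ {k} → Fin k → Fin k → Fm k) → ∀ {k} → Fin k → Fin k → Fm k
  blockF _≺_ a z = (a ≺ z) ∧' ∀' (¬' (markedF zero ∧' ((suc a ≺ zero) ∧' (zero ≺ suc z))))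

  pointsToF : ∀ {k} → Fin k → Fin k → Fm k
  pointsToF x y = ∃' (¬' (markedF zero) ∧' (blockF less₁F (suc x) zero ∧' blockF less₂F (suc y) zero))

  adjacentF : ∀ {k} → Fin k → Fin k → Fm k
  adjacentF x y = pointsToF x y ∨' pointsToF y x

T₁ : ℕ → CopyingTrans GSig PSig
T₁ c = record
  { blowing = suc c
  ; simple  = record
    { marks  = #marks c
    ; interp = record
      { ρ₀   = ⊤'
      ; ρRel = λ { less₁ → order₁F zero (suc zero) ; less₂ → order₂F zero (suc zero) } } } }
  where open OrderFormulas c

T₂ : SimpleTrans PSig GSig
T₂ = record
  { marks  = 1
  ; interp = record
    { ρ₀   = markedF zero
    ; ρRel = λ { edge → adjacentF zero (suc zero) ; less → less₁F zero (suc zero) } } }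
  where open EdgeFormulas

module Encoding {c : ℕ} {G : Str GSig} (graph : IsOrderedGraph G)
                {col : Fin (size G) → Fin c} (star : IsStarColoring G c col) where

  open StarColouring {G = G} star (proj₁ graph)
  open OrderFormulas c
  open EdgeFormulas using (blockF; less₁F; less₂F; pointsToF)

  n m N : ℕ
  n = size G
  m = suc c
  N = n * m

  p : Fin N → Fin n
  p = quotient m

  idx : Fin N → Fin m
  idx = remainder {n} m

  copy : Fin n → Fin m → Fin N
  copy = combine

  vertex : Fin n → Fin N
  vertex v = copy v zero

  p-copy : ∀ v k → p (copy v k) ≡ v
  p-copy v k = cong proj₁ (remQuot-combine v k)

  idx-copy : ∀ v k → idx (copy v k) ≡ k
  idx-copy v k = cong proj₂ (remQuot-combine v k)

  p-surjective : ∀ v → ∃ λ x → p x ≡ v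
  p-surjective v = vertex v , p-copy v zero

  IsVertex : Fin N → Bool
  IsVertex x = does (idx x Fin.≟ zero)

  vertex-isVertex : ∀ v → IsVertex (vertex v) ≡ true
  vertex-isVertex v = dec-true (idx (vertex v) Fin.≟ zero) (idx-copy v zero)

  isVertex⇒vertex : ∀ x → IsVertex x ≡ true → vertex (p x) ≡ x
  isVertex⇒vertex x x-vertex =
    trans (cong (copy (p x)) (sym (does-true⇒ (idx x Fin.≟ zero) x-vertex))) (combine-remQuot {n} m x)

  p-injective-on-vertices : ∀ x y → IsVertex x ≡ true → IsVertex y ≡ true → p x ≡ p y → x ≡ y
  p-injective-on-vertices x y x-vertex y-vertex px≡py =
    trans (sym (isVertex⇒vertex x x-vertex)) (trans (cong vertex px≡py) (isVertex⇒vertex y y-vertex))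

  _<ᴳ_ : Fin n → Fin n → Bool
  u <ᴳ v = rel G less (u ∷ v ∷ [])

  _<ᶦ_ : Fin m → Fin m → Bool
  k <ᶦ l = does (k Fin.<? l)

  <ᶦ-linear : IsStrictLinear (Fin m) _<ᶦ_
  <ᶦ-linear = strictTotalOrder⇒linear Fin.<-isStrictTotalOrder Fin._<?_

  vertex-index-least : ∀ {x y} → IsVertex x ≡ true → IsVertex y ≡ false → idx x <ᶦ idx y ≡ true
  vertex-index-least {x} {y} x-vertex y-copy with idx y | does-true⇒ (idx x Fin.≟ zero) x-vertex
  ... | zero  | _    = ⊥-elim (true≢false (dec-true (Fin._≟_ {m} zero zero) refl) y-copy)
  ... | suc k | idx≡ = dec-true (idx x Fin.<? suc k) (subst (_< suc k) (sym idx≡) z<s)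

  markHolds : Mark c → Fin N → Bool
  markHolds (index-is l)       x = does (idx x Fin.≟ l)
  markHolds (index-below l)    x = idx x <ᶦ l
  markHolds (colour-is i)      x = does (col (p x) Fin.≟ i)
  markHolds (is-centre-of i j) x = does (centre i j (p x) Fin.≟ p x)

  marked : Str (blowSig GSig ⁺ #marks c)
  marked = expand (G • m) (#marks c) (markHolds ∘ Inverse.to (mark-enumeration c))

  ⟦markF⟧ : ∀ {k} μ (x : Fin k) ρ → ⟦ markF μ x ⟧ marked ρ ≡ markHolds μ (ρ x)
  ⟦markF⟧ μ x ρ = cong (λ ν → markHolds ν (ρ x)) (Inverse.strictlyInverseˡ (mark-enumeration c) μ)

  key₁ : Fin N → Fin n × Fin m
  key₁ x = p x , idx x

  key₁-injective : Injective _≡_ _≡_ key₁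
  key₁-injective {x} {y} e = trans (sym (combine-remQuot {n} m x)) (trans (cong (uncurry copy) e) (combine-remQuot {n} m y))

  order₁ : Fin N → Fin N → Bool
  order₁ x y = lex Fin._≟_ _<ᴳ_ _<ᶦ_ (key₁ x) (key₁ y)

  order₁-linear : IsStrictLinear (Fin N) order₁
  order₁-linear = linear-pullback (lex-linear Fin._≟_ (proj₂ (proj₂ graph)) <ᶦ-linear) key₁ key₁-injective

  ⟦order₁F⟧ : ∀ {k} (x y : Fin k) ρ → ⟦ order₁F x y ⟧ marked ρ ≡ order₁ (ρ x) (ρ y)
  ⟦order₁F⟧ x y ρ = ⟦lexF⟧ marked ρ (lessF x y) (sameVertexF x y) (indexLtF x y) refl refl indexLt
    where
    indexLt : ⟦ indexLtF x y ⟧ marked ρ ≡ idx (ρ x) <ᶦ idx (ρ y)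
    indexLt =
      trans (⟦⋁⟧ marked ρ (suc c) (λ l → markF (index-is l) y ∧' markF (index-below l) x))
     (trans (anyFin-cong (suc c) (λ l → cong₂ _∧_ (⟦markF⟧ (index-is l) y ρ) (⟦markF⟧ (index-below l) x ρ)))
            (anyFin-≟ Fin._≟_ (suc c) id (idx (ρ y)) (idx (ρ x) <ᶦ_) (idx (ρ y) , refl)))

  Pointer : Fin N → Fin n → Bool
  Pointer x v = does (idx x Fin.≟ suc (col v)) ∧ PointsTo (p x) v

  ⟦pointerF⟧ : ∀ {k} (x a : Fin k) ρ → ⟦ pointerF x a ⟧ marked ρ ≡ Pointer (ρ x) (p (ρ a))
  ⟦pointerF⟧ {k} x a ρ =
    trans (⟦⋁⟧ marked ρ c (λ i → markF (colour-is i) x ∧' ⋁ c (Choice i)))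
   (trans (anyFin-cong c (λ i → cong₂ _∧_ (⟦markF⟧ (colour-is i) x ρ) (inner i)))
          (anyFin-≟ Fin._≟_ c id (col u) (λ i → Pointing i (col v)) (col u , refl)))
    where
    u v : Fin n
    u = p (ρ x)
    v = p (ρ a)
    Pointing : Fin c → Fin c → Bool
    Pointing i j = does (idx (ρ x) Fin.≟ suc j) ∧ (Edge G u v ∧ does (centre i j v Fin.≟ v))
    Choice : Fin c → Fin c → Fm k
    Choice i j = markF (colour-is j) a ∧' (markF (index-is (suc j)) x ∧' (edgeF x a ∧' markF (is-centre-of i j) a))
    inner : ∀ i → ⟦ ⋁ c (Choice i) ⟧ marked ρ ≡ Pointing i (col v)
    inner i =
      trans (⟦⋁⟧ marked ρ c (Choice i))
     (trans (anyFin-cong c (λ j → cong₂ _∧_ (⟦markF⟧ (colour-is j) a ρ)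
                                  (cong₂ _∧_ (⟦markF⟧ (index-is (suc j)) x ρ)
                                             (cong (Edge G u v ∧_) (⟦markF⟧ (is-centre-of i j) a ρ)))))
            (anyFin-≟ Fin._≟_ c id (col v) (Pointing i) (col v , refl)))

  Targets : Fin N → Fin n → Bool
  Targets x v = if IsVertex x then does (p x Fin.≟ v) else Pointer x v

  ⟦targetsF⟧ : ∀ {k} (x a : Fin k) ρ → ⟦ targetsF x a ⟧ marked ρ ≡ Targets (ρ x) (p (ρ a))
  ⟦targetsF⟧ x a ρ =
    trans (⟦ifF⟧ marked ρ (vertexCopyF x) (sameVertexF x a) (pointerF x a))
          (cong₂ (λ b d → if b then does (p (ρ x) Fin.≟ p (ρ a)) else d)
                 (⟦markF⟧ (index-is zero) x ρ) (⟦pointerF⟧ x a ρ))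

  targets-functional : ∀ {x v w} → Targets x v ≡ true → Targets x w ≡ true → v ≡ w
  targets-functional {x} {v} {w} with IsVertex x
  ... | true  = λ xv xw → trans (sym (does-true⇒ (p x Fin.≟ v) xv)) (does-true⇒ (p x Fin.≟ w) xw)
  ... | false = λ xv xw →
    let xv-index , uv = ∧-≡true⁻ xv ; xw-index , uw = ∧-≡true⁻ xw in
    pointsTo-functional uv uw
      (Fin.suc-injective (trans (sym (does-true⇒ (idx x Fin.≟ _) xv-index)) (does-true⇒ (idx x Fin.≟ _) xw-index)))

  nonvertex-targets⇒pointsTo : ∀ {x v} → IsVertex x ≡ false → Targets x v ≡ true → PointsTo (p x) v ≡ true
  nonvertex-targets⇒pointsTo {x} {v} x-copy xv rewrite x-copy = proj₂ (∧-≡true⁻ {does (idx x Fin.≟ suc (col v))} xv)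

  HasTarget : Fin N → Bool
  HasTarget x = anyFin N (λ a → Targets x (p a))

  ⟦hasTargetF⟧ : ∀ {k} (x : Fin k) ρ → ⟦ hasTargetF x ⟧ marked ρ ≡ HasTarget (ρ x)
  ⟦hasTargetF⟧ x ρ = anyFin-cong N (λ a → ⟦targetsF⟧ (suc x) zero (extend a ρ))

  hasTarget-true : ∀ {x v} → Targets x v ≡ true → HasTarget x ≡ true
  hasTarget-true {x} {v} xv = ∃⇒anyFin N (vertex v) (subst (λ w → Targets x w ≡ true) (sym (p-copy v zero)) xv)

  hasTarget-false : ∀ {x} → (∀ v → Targets x v ≡ false) → HasTarget x ≡ false
  hasTarget-false {x} none = trans (anyFin-surjective p p-surjective (Targets x)) (anyFin-false n none)

  private
    targetFrom : ∀ x → Dec (∃ λ v → Targets x v ≡ true) → Fin n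
    targetFrom x (yes (v , _)) = v
    targetFrom x (no _)        = p x

  target : Fin N → Fin n
  target x = targetFrom x (Fin.any? λ v → Targets x v Bool.≟ true)

  TargetIs : Fin N → Fin n → Bool
  TargetIs x v = if HasTarget x then Targets x v else does (p x Fin.≟ v)

  targetIs-hasTarget : ∀ {x v} → HasTarget x ≡ true → TargetIs x v ≡ Targets x v
  targetIs-hasTarget {x} {v} hx = cong (λ b → if b then Targets x v else does (p x Fin.≟ v)) hx

  targetIs-spec : ∀ x v → TargetIs x v ≡ does (target x Fin.≟ v)
  targetIs-spec x v = by-cases (Fin.any? λ w → Targets x w Bool.≟ true)
    where
    by-cases : (d : Dec (∃ λ w → Targets x w ≡ true)) → TargetIs x v ≡ does (targetFrom x d Fin.≟ v)
    by-cases (yes (t , xt)) =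
      trans (targetIs-hasTarget (hasTarget-true xt))
            (⇔→≡ (mk⇔ (λ xv → dec-true (t Fin.≟ v) (targets-functional xt xv))
                      (λ t≡v → subst (λ w → Targets x w ≡ true) (does-true⇒ (t Fin.≟ v) t≡v) xt)))
    by-cases (no none) =
      cong (λ b → if b then Targets x v else does (p x Fin.≟ v)) (hasTarget-false (λ w → ¬-not (λ xw → none (w , xw))))

  ⟦targetIsF⟧ : ∀ {k} (x a : Fin k) ρ → ⟦ targetIsF x a ⟧ marked ρ ≡ TargetIs (ρ x) (p (ρ a))
  ⟦targetIsF⟧ x a ρ =
    trans (⟦ifF⟧ marked ρ (hasTargetF x) (targetsF x a) (sameVertexF x a))
          (cong₂ (λ b d → if b then d else does (p (ρ x) Fin.≟ p (ρ a))) (⟦hasTargetF⟧ x ρ) (⟦targetsF⟧ x a ρ))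

  target-of-targets : ∀ {x v} → Targets x v ≡ true → target x ≡ v
  target-of-targets {x} {v} xv = does-true⇒ (target x Fin.≟ v)
    (trans (sym (targetIs-spec x v)) (trans (targetIs-hasTarget (hasTarget-true xv)) xv))

  targets-target : ∀ {x} → HasTarget x ≡ true → Targets x (target x) ≡ true
  targets-target {x} hx =
    trans (sym (targetIs-hasTarget hx))
          (trans (targetIs-spec x (target x)) (dec-true (target x Fin.≟ target x) refl))

  ⟦onTargetsF⟧ : ∀ (ψ : ∀ {k} → Fin k → Fin k → Fm k) (r : Fin n → Fin n → Bool) →
    (∀ {k} (x y : Fin k) ρ → ⟦ ψ x y ⟧ marked ρ ≡ r (p (ρ x)) (p (ρ y))) →
    ∀ {k} (x y : Fin k) ρ → ⟦ onTargetsF ψ x y ⟧ marked ρ ≡ r (target (ρ x)) (target (ρ y))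
  ⟦onTargetsF⟧ ψ r ⟦ψ⟧ x y ρ =
    trans (anyFin-cong N λ a → anyFin-cong N λ b →
             cong₂ _∧_ (trans (⟦targetIsF⟧ (suc (suc x)) (suc zero) (extend b (extend a ρ))) (targetIs-spec (ρ x) (p a)))
                       (cong₂ _∧_ (trans (⟦targetIsF⟧ (suc (suc y)) zero (extend b (extend a ρ))) (targetIs-spec (ρ y) (p b)))
                                  (⟦ψ⟧ (suc zero) zero (extend b (extend a ρ)))))
   (trans (anyFin-cong N λ a →
             trans (anyFin-∧ˡ N (does (tx Fin.≟ p a)))
                   (cong (does (tx Fin.≟ p a) ∧_) (anyFin-≟ Fin._≟_ N p ty (r (p a)) (p-surjective ty))))
          (anyFin-≟ Fin._≟_ N p tx (λ u → r u ty) (p-surjective tx)))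
    where
    tx ty : Fin n
    tx = target (ρ x)
    ty = target (ρ y)

  Image₂ : Set
  Image₂ = Bool × Fin n

  φ₂ : Fin N → Image₂
  φ₂ x = HasTarget x , target x

  _≺₂_ : Image₂ → Image₂ → Bool
  _≺₂_ = lex Bool._≟_ boolLt _<ᴳ_

  _≟₂_ : DecidableEquality Image₂
  _≟₂_ = ≡-dec Bool._≟_ Fin._≟_

  key₂ : Fin N → Image₂ × (Bool × (Fin n × Fin m))
  key₂ x = φ₂ x , (not (IsVertex x) , key₁ x)

  order₂K : Image₂ × (Bool × (Fin n × Fin m)) → Image₂ × (Bool × (Fin n × Fin m)) → Bool
  order₂K = lex _≟₂_ _≺₂_ (lex Bool._≟_ boolLt (lex Fin._≟_ _<ᴳ_ _<ᶦ_))

  order₂ : Fin N → Fin N → Bool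
  order₂ x y = order₂K (key₂ x) (key₂ y)

  ≺₂-linear : IsStrictLinear Image₂ _≺₂_
  ≺₂-linear = lex-linear Bool._≟_ boolLt-linear (proj₂ (proj₂ graph))

  order₂-linear : IsStrictLinear (Fin N) order₂
  order₂-linear =
    linear-pullback (lex-linear _≟₂_ ≺₂-linear (lex-linear Bool._≟_ boolLt-linear
                                                 (lex-linear Fin._≟_ (proj₂ (proj₂ graph)) <ᶦ-linear)))
                    key₂ (key₁-injective ∘ cong (proj₂ ∘ proj₂))

  ⟦order₂F⟧ : ∀ {k} (x y : Fin k) ρ → ⟦ order₂F x y ⟧ marked ρ ≡ order₂ (ρ x) (ρ y)
  ⟦order₂F⟧ {k} x y ρ =
    ⟦lexF⟧ marked ρ
      (lexF (boolLtF Hx Hy) (boolEqF Hx Hy) (onTargetsF lessF x y))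
      (boolEqF Hx Hy ∧' onTargetsF sameVertexF x y)
      (lexF (boolLtF Cx Cy) (boolEqF Cx Cy) (order₁F x y))
      (⟦lexF⟧ marked ρ (boolLtF Hx Hy) (boolEqF Hx Hy) (onTargetsF lessF x y)
        (⟦boolLtF⟧ marked ρ Hx Hy hx hy) (⟦boolEqF⟧ marked ρ Hx Hy hx hy)
        (⟦onTargetsF⟧ lessF _<ᴳ_ (λ _ _ _ → refl) x y ρ))
      (trans (cong₂ _∧_ (⟦boolEqF⟧ marked ρ Hx Hy hx hy)
                        (⟦onTargetsF⟧ sameVertexF (λ u v → does (u Fin.≟ v)) (λ _ _ _ → refl) x y ρ))
             (sym (does-≡-dec Bool._≟_ Fin._≟_ (HasTarget (ρ x)) (HasTarget (ρ y)) (target (ρ x)) (target (ρ y)))))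
      (⟦lexF⟧ marked ρ (boolLtF Cx Cy) (boolEqF Cx Cy) (order₁F x y)
        (⟦boolLtF⟧ marked ρ Cx Cy cx cy) (⟦boolEqF⟧ marked ρ Cx Cy cx cy) (⟦order₁F⟧ x y ρ))
    where
    Hx Hy Cx Cy : Fm k
    Hx = hasTargetF x
    Hy = hasTargetF y
    Cx = ¬' (vertexCopyF x)
    Cy = ¬' (vertexCopyF y)
    hx : ⟦ Hx ⟧ marked ρ ≡ HasTarget (ρ x)
    hx = ⟦hasTargetF⟧ x ρ
    hy : ⟦ Hy ⟧ marked ρ ≡ HasTarget (ρ y)
    hy = ⟦hasTargetF⟧ y ρ
    cx : ⟦ Cx ⟧ marked ρ ≡ not (IsVertex (ρ x))
    cx = cong not (⟦markF⟧ (index-is zero) x ρ)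
    cy : ⟦ Cy ⟧ marked ρ ≡ not (IsVertex (ρ y))
    cy = cong not (⟦markF⟧ (index-is zero) y ρ)

  permutation : Str PSig
  permutation = record
    { size = N
    ; rel  = λ { less₁ (x ∷ y ∷ []) → order₁ x y ; less₂ (x ∷ y ∷ []) → order₂ x y } }

  permutation-isPermutation : IsPermutation permutation
  permutation-isPermutation = order₁-linear , order₂-linear

  encoding : T₁ c ∋꜀ G ⟶ permutation
  encoding = markHolds ∘ Inverse.to (mark-enumeration c) , id , id , (λ _ → refl) , (λ x _ → x , refl) , relations
    where
    relations : ∀ s (t : Vec (Fin N) 2) → rel permutation s t ≡ ⟦ ρRel (interp (simple (T₁ c))) s ⟧ marked (lookup t)
    relations less₁ (x ∷ y ∷ []) = sym (⟦order₁F⟧ zero (suc zero) (lookup (x ∷ y ∷ [])))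
    relations less₂ (x ∷ y ∷ []) = sym (⟦order₂F⟧ zero (suc zero) (lookup (x ∷ y ∷ [])))

  _◁₁_ _◁₂_ : Fin N → Fin N → Bool
  _◁₁_ = Blocks._◁_ order₁ IsVertex
  _◁₂_ = Blocks._◁_ order₂ IsVertex

  vertex-first₁ : ∀ a z → IsVertex a ≡ true → IsVertex z ≡ false → p a ≡ p z → order₁ a z ≡ true
  vertex-first₁ a z a-vertex z-copy pa≡pz =
    subst (λ u → lex Fin._≟_ _<ᴳ_ _<ᶦ_ (u , idx a) (key₁ z) ≡ true) (sym pa≡pz)
          (lex-tail Fin._≟_ (vertex-index-least a-vertex z-copy))

  module Blocks₁ = Blocks.Characterisation order₁ IsVertex order₁-linear Fin._≟_ (proj₂ (proj₂ graph)) p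
                          (λ _ _ → lex-head Fin._≟_) vertex-first₁ p-injective-on-vertices

  ◁₁-of-vertex : ∀ {u z} → IsVertex z ≡ false → p z ≡ u → vertex u ◁₁ z ≡ true
  ◁₁-of-vertex {u} z-copy pz≡u = Blocks₁.◁-of-same-image (vertex-isVertex u) z-copy (trans (p-copy u zero) (sym pz≡u))

  ◁₁-of-vertex⁻ : ∀ {u z} → IsVertex z ≡ false → vertex u ◁₁ z ≡ true → p z ≡ u
  ◁₁-of-vertex⁻ {u} {z} z-copy u◁z =
    trans (sym (Blocks₁.◁-same-image z-copy (vertex-isVertex (p z)) (p-copy (p z) zero) u◁z)) (p-copy u zero)

  vertex-targets-itself : ∀ {a} → IsVertex a ≡ true → Targets a (p a) ≡ true
  vertex-targets-itself {a} a-vertex =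
    trans (cong (λ b → if b then does (p a Fin.≟ p a) else Pointer a (p a)) a-vertex) (dec-true (p a Fin.≟ p a) refl)

  φ₂-of-targets : ∀ {x v} → Targets x v ≡ true → φ₂ x ≡ (true , v)
  φ₂-of-targets xv = cong₂ _,_ (hasTarget-true xv) (target-of-targets xv)

  φ₂-vertex : ∀ v → φ₂ (vertex v) ≡ (true , v)
  φ₂-vertex v = trans (φ₂-of-targets (vertex-targets-itself (vertex-isVertex v))) (cong (true ,_) (p-copy v zero))

  vertex-first₂ : ∀ a z → IsVertex a ≡ true → IsVertex z ≡ false → φ₂ a ≡ φ₂ z → order₂ a z ≡ true
  vertex-first₂ a z a-vertex z-copy φ₂a≡φ₂z =
    subst (λ ι → order₂K (ι , (not (IsVertex a) , key₁ a)) (key₂ z) ≡ true) (sym φ₂a≡φ₂z)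
          (lex-tail _≟₂_ (lex-head Bool._≟_
            (subst₂ (λ b b′ → boolLt b b′ ≡ true) (cong not (sym a-vertex)) (cong not (sym z-copy)) refl)))

  φ₂-injective-on-vertices : ∀ a w → IsVertex a ≡ true → IsVertex w ≡ true → φ₂ a ≡ φ₂ w → a ≡ w
  φ₂-injective-on-vertices a w a-vertex w-vertex φ₂a≡φ₂w =
    p-injective-on-vertices a w a-vertex w-vertex
      (,-injectiveʳ (trans (sym (φ₂-of-targets (vertex-targets-itself a-vertex)))
                           (trans φ₂a≡φ₂w (φ₂-of-targets (vertex-targets-itself w-vertex)))))

  module Blocks₂ = Blocks.Characterisation order₂ IsVertex order₂-linear _≟₂_ ≺₂-linear φ₂
                          (λ _ _ → lex-head _≟₂_) vertex-first₂ φ₂-injective-on-vertices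

  hasTarget-after-vertex : ∀ {v z} → order₂ (vertex v) z ≡ true → HasTarget z ≡ true
  hasTarget-after-vertex {v} {z} v<z = by-cases (HasTarget z) refl
    where
    by-cases : ∀ b → HasTarget z ≡ b → HasTarget z ≡ true
    by-cases true  e = e
    by-cases false e = ⊥-elim (linear-asym order₂-linear v<z (lex-head _≟₂_ (lex-head Bool._≟_
      (subst₂ (λ b b′ → boolLt b b′ ≡ true) (sym e) (sym (cong proj₁ (φ₂-vertex v))) refl))))

  ◁₂-of-vertex : ∀ {v z} → IsVertex z ≡ false → φ₂ z ≡ (true , v) → vertex v ◁₂ z ≡ true
  ◁₂-of-vertex {v} z-copy φ₂z≡ = Blocks₂.◁-of-same-image (vertex-isVertex v) z-copy (trans (φ₂-vertex v) (sym φ₂z≡))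

  ◁₂-of-vertex⁻ : ∀ {v z} → IsVertex z ≡ false → vertex v ◁₂ z ≡ true → φ₂ z ≡ (true , v)
  ◁₂-of-vertex⁻ {v} {z} z-copy v◁z =
    trans (sym (Blocks₂.◁-same-image z-copy (vertex-isVertex (target z)) φ₂w≡φ₂z v◁z)) (φ₂-vertex v)
    where
    φ₂w≡φ₂z : φ₂ (vertex (target z)) ≡ φ₂ z
    φ₂w≡φ₂z = trans (φ₂-vertex (target z))
                    (cong (_, target z) (sym (hasTarget-after-vertex (proj₁ (Blocks.◁-elim order₂ IsVertex v◁z)))))

  pointerCopy : Fin n → Fin n → Fin N
  pointerCopy u v = copy u (suc (col v))

  pointerCopy-copy : ∀ u v → IsVertex (pointerCopy u v) ≡ false
  pointerCopy-copy u v = dec-false (idx (pointerCopy u v) Fin.≟ zero) (λ e → Fin.0≢1+n (trans (sym e) (idx-copy u (suc (col v)))))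

  pointerCopy-targets : ∀ {u v} → PointsTo u v ≡ true → Targets (pointerCopy u v) v ≡ true
  pointerCopy-targets {u} {v} uv =
    trans (cong (λ b → if b then does (p z Fin.≟ v) else Pointer z v) (pointerCopy-copy u v))
          (∧-≡true (dec-true (idx z Fin.≟ suc (col v)) (idx-copy u (suc (col v))))
                   (subst (λ w → PointsTo w v ≡ true) (sym (p-copy u (suc (col v)))) uv))
    where
    z : Fin N
    z = pointerCopy u v

  pointsTo-decoding : ∀ u v → anyFin N (λ z → not (IsVertex z) ∧ (vertex u ◁₁ z ∧ vertex v ◁₂ z)) ≡ PointsTo u v
  pointsTo-decoding u v = ⇔→≡ (mk⇔ decode encode)
    where
    decode : anyFin N (λ z → not (IsVertex z) ∧ (vertex u ◁₁ z ∧ vertex v ◁₂ z)) ≡ true → PointsTo u v ≡ true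
    decode e with anyFin⇒∃ N e
    ... | z , ez =
      let z-copy′ , blocks = ∧-≡true⁻ {not (IsVertex z)} ez
          u◁z , v◁z = ∧-≡true⁻ blocks
          z-copy = Bool.not-injective z-copy′
          φ₂z≡ = ◁₂-of-vertex⁻ z-copy v◁z
      in subst₂ (λ a b → PointsTo a b ≡ true) (◁₁-of-vertex⁻ z-copy u◁z) (cong proj₂ φ₂z≡)
                (nonvertex-targets⇒pointsTo z-copy (targets-target (cong proj₁ φ₂z≡)))
    encode : PointsTo u v ≡ true → anyFin N (λ z → not (IsVertex z) ∧ (vertex u ◁₁ z ∧ vertex v ◁₂ z)) ≡ true
    encode uv = ∃⇒anyFin N (pointerCopy u v)
      (∧-≡true (cong not (pointerCopy-copy u v))
               (∧-≡true (◁₁-of-vertex (pointerCopy-copy u v) (p-copy u (suc (col v))))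
                        (◁₂-of-vertex (pointerCopy-copy u v) (φ₂-of-targets (pointerCopy-targets uv)))))

  markedPermutation : Str (PSig ⁺ 1)
  markedPermutation = expand permutation 1 (λ _ → IsVertex)

  ⟦blockF⟧ : ∀ (_≺_ : ∀ {k} → Fin k → Fin k → EdgeFormulas.Fm k) (r : Fin N → Fin N → Bool) →
    (∀ {k} (x y : Fin k) ρ → ⟦ x ≺ y ⟧ markedPermutation ρ ≡ r (ρ x) (ρ y)) →
    ∀ {k} (a z : Fin k) ρ → ⟦ blockF _≺_ a z ⟧ markedPermutation ρ ≡ Blocks._◁_ r IsVertex (ρ a) (ρ z)
  ⟦blockF⟧ _≺_ r ⟦≺⟧ a z ρ =
    cong₂ _∧_ (⟦≺⟧ a z ρ)
              (allFin-cong N λ w → cong (λ b → not (IsVertex w ∧ b))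
                                        (cong₂ _∧_ (⟦≺⟧ (suc a) zero (extend w ρ)) (⟦≺⟧ zero (suc z) (extend w ρ))))

  ⟦pointsToF⟧ : ∀ {k} (x y : Fin k) ρ →
    ⟦ pointsToF x y ⟧ markedPermutation ρ ≡ anyFin N (λ z → not (IsVertex z) ∧ (ρ x ◁₁ z ∧ ρ y ◁₂ z))
  ⟦pointsToF⟧ x y ρ = anyFin-cong N λ z → cong (not (IsVertex z) ∧_)
    (cong₂ _∧_ (⟦blockF⟧ less₁F order₁ (λ _ _ _ → refl) (suc x) zero (extend z ρ))
               (⟦blockF⟧ less₂F order₂ (λ _ _ _ → refl) (suc y) zero (extend z ρ)))

  vertex-order₁ : ∀ u v → order₁ (vertex u) (vertex v) ≡ u <ᴳ v
  vertex-order₁ u v =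
    trans (cong₂ (lex Fin._≟_ _<ᴳ_ _<ᶦ_) (cong₂ _,_ (p-copy u zero) (idx-copy u zero))
                                         (cong₂ _,_ (p-copy v zero) (idx-copy v zero)))
          (lex-same-tail Fin._≟_ (proj₁ <ᶦ-linear zero))

  decoding : T₂ ∋ₛ permutation ⟶ G
  decoding =
    (λ _ → IsVertex) , vertex , (λ {u} {v} → combine-injectiveˡ u zero v zero) , vertex-isVertex ,
    (λ x x-vertex → p x , isVertex⇒vertex x x-vertex) , relations
    where
    relations : ∀ s (t : Vec (Fin n) 2) → rel G s t ≡ ⟦ ρRel (interp T₂) s ⟧ markedPermutation (vertex ∘ lookup t)
    relations edge (u ∷ v ∷ []) =
      trans (edge-orientation u v)
            (sym (cong₂ _∨_ (trans (⟦pointsToF⟧ zero (suc zero) ρ) (pointsTo-decoding u v))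
                            (trans (⟦pointsToF⟧ (suc zero) zero ρ) (pointsTo-decoding v u))))
      where
      ρ : Fin 2 → Fin N
      ρ = vertex ∘ lookup (u ∷ v ∷ [])
    relations less (u ∷ v ∷ []) = sym (vertex-order₁ u v)

mainTheorem10 : (c : ℕ) (𝒢 : Str GSig → Set)
    → (∀ G → 𝒢 G → IsOrderedGraph G × StarChromatic≤ G c)
    → Σ (CopyingTrans GSig PSig) λ T₁ → blowing T₁ ≡ suc c
      × Σ (SimpleTrans PSig GSig) λ T₂ →
        Σ (Str PSig → Set) λ 𝒫 →
          (∀ P → 𝒫 P → IsPermutation P)
          × TransductionPairing 𝒢 𝒫 (λ A B → T₁ ∋꜀ A ⟶ B) (λ B A → T₂ ∋ₛ B ⟶ A)
mainTheorem10 c 𝒢 𝒢-star = T₁ c , refl , T₂ , 𝒫 , (λ _ (_ , _ , _ , _ , isPerm) → isPerm) , encode , decode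
  where
  𝒫 : Str PSig → Set
  𝒫 P = Σ (Str GSig) λ G → 𝒢 G × (T₁ c ∋꜀ G ⟶ P) × (T₂ ∋ₛ P ⟶ G) × IsPermutation P

  encode : ∀ G → 𝒢 G → Σ (Str PSig) λ P → (T₁ c ∋꜀ G ⟶ P) × 𝒫 P × (T₂ ∋ₛ P ⟶ G)
  encode G G∈𝒢 with 𝒢-star G G∈𝒢
  ... | graph , _ , star = let open Encoding {G = G} graph star in
    permutation , encoding , (G , G∈𝒢 , encoding , decoding , permutation-isPermutation) , decoding

  decode : ∀ P → 𝒫 P → Σ (Str GSig) λ G → (T₂ ∋ₛ P ⟶ G) × 𝒢 G × (T₁ c ∋꜀ G ⟶ P)
  decode P (G , G∈𝒢 , encoded , decoded , _) = G , decoded , G∈𝒢 , encoded
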